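{- Let $\ell$ be a positive integer, $H$ a graph, and $(G,\mathcal{Z})$ a rooted graph with a separation $(A,B)$ in $G$ such that $\|\mathcal{Z}\setminus A\|=\ell'$ for some integer $1\le\ell'<\ell$. Let $\mathcal{Z}'$ be the multiset of all members $X$ of $\mathcal{Z}$ with $X\subseteq V(A)$. If $T$ is a pure $(H,\mathcal{Z}',\ell-\ell')$-deletion set of the graph $A-V(B)$ (with the sets of $\mathcal{Z}'$ restricted to $V(A)\setminus V(B)$), then $T\cup V(A\cap B)$ is a pure $(H,\mathcal{Z},\ell)$-deletion set of $G$.
   Context: All graphs are finite, simple, undirected. A minor-model function of a graph $H'$ in $G$ is a map $\eta$ on $V(H')\cup E(H')$ with the $\eta(v)$ pairwise vertex-disjoint non-empty connected subgraphs, the $\eta(e)$ pairwise distinct edges, and for $e=uv$, $\eta(e)$ joining $V(\eta(u))$ to $V(\eta(v))$; its image is the union of the $\eta(v)$ with the edges $\eta(e)$. A rooted graph $(G,\mathcal{Z})$ is a graph with a finite multiset $\mathcal{Z}=\{Z_1,\dots,Z_m\}$ of subsets of $V(G)$. A separation is a pair $(A,B)$ of subgraphs with $A\cup B=G$, $E(A)\cap E(B)=\emptyset$; $A-V(B)$ is $A$ with the vertices of $B$ removed; $\|\mathcal{Z}\setminus A\|$ is the number of indices $i$ with $Z_i\not\subseteq V(A)$. A pure $(H,\mathcal{Z},\ell)$-model is a subgraph $F$ for which there exist distinct components $H_1,\dots,H_t$ of $H$, a model function $\eta$ of $H_1\cup\dots\cup H_t$ with image $F$, and pairwise disjoint non-empty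 $\alpha(1),\dots,\alpha(t)\subseteq[m]$ with $|\bigcup_s\alpha(s)|=\ell$ such that for each $s$ and $j\in\alpha(s)$ the image of $H_s$ meets $Z_j$. A pure $(H,\mathcal{Z},\ell)$-deletion set is $S\subseteq V(G)$ such that $G-S$ has no pure $(H,\mathcal{Z},\ell)$-model. -}

module Defs where

open import Level using (0ℓ)
open import Data.Nat using (ℕ; suc)
open import Data.Fin using (Fin)
open import Data.Fin.Subset using (Subset; _∈_; _∉_; _⊆_; _∩_; _∪_; _─_; ⊤; ⋃; ∣_∣; Nonempty; Empty)
open import Data.Fin.Subset.Properties using (_⊆?_)
open import Data.List using (List; length; filter; map; lookup; tabulate)
open import Data.Product using (Σ; ∃; _×_; _,_; proj₁; proj₂)
open import Data.Sum using (_⊎_)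
open import Data.Empty using (⊥)
open import Relation.Nullary using (¬_; ¬?)
open import Relation.Binary.PropositionalEquality using (_≡_; _≢_)

record Graph : Set₁ where
  field
    n      : ℕ
    Adj    : Fin n → Fin n → Set
    sym    : ∀ {u v} → Adj u v → Adj v u
    irrefl : ∀ {u} → ¬ Adj u u
open Graph public

data Walk {n : ℕ} (E : Fin n → Fin n → Set) : Fin n → Fin n → Set where
  here : ∀ {u} → Walk E u u
  step : ∀ {u w v} → E u w → Walk E w v → Walk E u v

record Sub (G : Graph) : Set₁ where
  field
    V     : Subset (n G)
    E     : Fin (n G) → Fin (n G) → Set
    E-sym : ∀ {u v} → E u v → E v u
    E-ok  : ∀ {u v} → E u v → u ∈ V × v ∈ V × Adj G u v
open Sub public

_⊑_ : ∀ {G} → Sub G → Sub G → Set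
K ⊑ L = (V K ⊆ V L) × (∀ {u v} → E K u v → E L u v)

Connected : ∀ {G} → Sub G → Set
Connected K = Nonempty (V K) × (∀ {u v} → u ∈ V K → v ∈ V K → Walk (E K) u v)

whole : (G : Graph) → Sub G
whole G = record { V = ⊤ ; E = Adj G ; E-sym = sym G
                 ; E-ok = λ {u} {v} e → ∈⊤ u , ∈⊤ v , e }
  where
  open import Data.Fin.Subset.Properties using () renaming (∈⊤ to ∈⊤')
  ∈⊤ : ∀ x → x ∈ ⊤
  ∈⊤ x = ∈⊤' {x = x}

_-ᵥ_ : ∀ {G} → Sub G → Subset (n G) → Sub G
_-ᵥ_ {G} K S = record
  { V = V K ─ S
  ; E = λ u v → E K u v × u ∉ S × v ∉ S
  ; E-sym = λ { (e , u∉ , v∉) → E-sym K e , v∉ , u∉ }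
  ; E-ok = λ { {u} {v} (e , u∉ , v∉) →
      let (u∈ , v∈ , a) = E-ok K e in
      x∈p∧x∉q⇒x∈p─q u∈ u∉ , x∈p∧x∉q⇒x∈p─q v∈ v∉ , a } }
  where open import Data.Fin.Subset.Properties using (x∈p∧x∉q⇒x∈p─q)

IsSeparation : (G : Graph) → Sub G → Sub G → Set
IsSeparation G A B =
    (∀ x → x ∈ V A ⊎ x ∈ V B)
  × (∀ {u v} → Adj G u v → E A u v ⊎ E B u v)
  × (∀ {u v} → E A u v → E B u v → ⊥)

_minusV_ : ∀ {G} → Sub G → Sub G → Sub G
A minusV B = A -ᵥ V B

-- Rooted graphs: the multiset Z is a list of vertex subsets.

Roots : Graph → Set
Roots G = List (Subset (n G))

‖_∖_‖ : ∀ {G} → Roots G → Sub G → ℕ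
‖ Z ∖ A ‖ = length (filter (λ X → ¬? (X ⊆? V A)) Z)

restrictRoots : ∀ {G} → Roots G → Sub G → Sub G → Roots G
restrictRoots Z A B = map (λ X → X ∩ (V A ─ V B)) (filter (λ X → X ⊆? V A) Z)

IsComponent : (H : Graph) → Subset (n H) → Set
IsComponent H C =
    Nonempty C
  × (∀ {u v} → u ∈ C → Adj H u v → v ∈ C)
  × (∀ {u v} → u ∈ C → v ∈ C → Walk (Adj H) u v)

-- Model function of H₁ ∪ … ∪ H_t (vertex set U ⊆ V(H)) in the subgraph K of G.
record ModelFn (H : Graph) {G : Graph} (K : Sub G) (U : Subset (n H)) : Set₁ where
  field
    branch      : Fin (n H) → Sub G
    branch-sub  : ∀ {v} → v ∈ U → branch v ⊑ K
    branch-conn : ∀ {v} → v ∈ U → Connected (branch v)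
    branch-disj : ∀ {u v} → u ∈ U → v ∈ U → u ≢ v → Empty (V (branch u) ∩ V (branch v))
    edge        : ∀ {u v} → u ∈ U → v ∈ U → Adj H u v → Fin (n G) × Fin (n G)
    edge-ok     : ∀ {u v} (pu : u ∈ U) (pv : v ∈ U) (e : Adj H u v) →
                  let (a , b) = edge pu pv e in
                  E K a b × a ∈ V (branch u) × b ∈ V (branch v)
    edge-sym    : ∀ {u v} (pu : u ∈ U) (pv : v ∈ U) (e : Adj H u v) →
                  edge pv pu (sym H e) ≡ (proj₂ (edge pu pv e) , proj₁ (edge pu pv e))
    edge-inj    : ∀ {u v u' v'} (pu : u ∈ U) (pv : v ∈ U) (e : Adj H u v)
                  (pu' : u' ∈ U) (pv' : v' ∈ U) (e' : Adj H u' v') →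
                  edge pu pv e ≡ edge pu' pv' e' → (u ≡ u' × v ≡ v')

-- Pure (H, Z, ℓ)-model in the subgraph K (existence of the data defining
-- the image F).
record PureModel (H : Graph) {G : Graph} (K : Sub G) (Z : Roots G) (ℓ : ℕ) : Set₁ where
  field
    t       : ℕ
    comp    : Fin t → Subset (n H)
    comp-ok : ∀ s → IsComponent H (comp s)
    comp-distinct : ∀ {s s'} → s ≢ s' → comp s ≢ comp s'
    η       : ModelFn H K (⋃ (tabulate comp))
    α       : Fin t → Subset (length Z)
    α-nonempty : ∀ s → Nonempty (α s)
    α-disj  : ∀ {s s'} → s ≢ s' → Empty (α s ∩ α s')
    α-size  : ∣ ⋃ (tabulate α) ∣ ≡ ℓ
    meets   : ∀ s {j} → j ∈ α s →
              ∃ λ x → x ∈ lookup Z j ×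
                (∃ λ v → v ∈ comp s × x ∈ V (ModelFn.branch η v))

IsPureDeletionSet : (H : Graph) {G : Graph} (K : Sub G) (Z : Roots G) (ℓ : ℕ)
                    → Subset (n G) → Set₁
IsPureDeletionSet H K Z ℓ S = (S ⊆ V K) × ¬ PureModel H (K -ᵥ S) Z ℓ

module Submission where

-- Put S = T ∪ V(A ∩ B). An edge of G − S leaving V(B) stays outside V(B): it cannot lie in B,
-- and if it lies in A its other end, being in V(A) but not in S, is not in V(B) either.
-- Hence a branch set of a model in G − S that meets a root set X ⊆ V(A) lies in A − V(B) − T,
-- and, following model edges, so does the whole image of the component of H containing it.
-- Given a pure (H, Z, ℓ)-model in G − S, keep the components whose root indices include one of
-- the ℓ − ℓ' or more indices of Z' (at most ℓ' indices lie outside Z'), and assign to them exactly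
-- ℓ − ℓ' of those indices: this is a pure (H, Z', ℓ − ℓ')-model in A − V(B) − T.

open import Defs
open import Data.Nat using (ℕ; zero; suc; _≤_; _<_; _+_; _∸_; z≤n; s≤s)
open import Data.Nat.Properties using (≤-trans; ≤-reflexive; n≤1+n; +-suc; +-monoʳ-≤; ∸-monoˡ-≤; m+n∸n≡m)
open import Data.Fin using (Fin; zero; suc)
open import Data.Fin.Properties using (suc-injective)
open import Data.Fin.Subset using (Subset; _∈_; _∉_; _⊆_; _∩_; _∪_; _─_; ⊤; ⊥; ⋃; ∣_∣; Empty; inside; outside)
open import Data.Fin.Subset.Properties using (_⊆?_; x∈p∪q⁺; x∈p∪q⁻; ∉⊥; ∣⊥∣≡0; x∈p∩q⁺; x∈p∩q⁻; x∈p∧x∉q⇒x∈p─q; p─q⊆p; nonempty?; ⊆-antisym; p∩q⊆q; ∈⊤)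
open import Data.Vec using ([]; _∷_; here; there)
open import Data.List using ([]; _∷_; length; lookup; tabulate)
open import Data.Product using (Σ; ∃; _×_; _,_; proj₁; proj₂)
open import Data.Sum using (inj₁; inj₂)
open import Data.Empty using (⊥-elim)
open import Relation.Nullary using (¬_; Dec; yes; no)
open import Relation.Binary.PropositionalEquality using (_≡_; refl; cong; subst; subst₂) renaming (sym to ≡-sym; trans to ≡-trans)

⋃-tabulate⁺ : ∀ {m t} (f : Fin t → Subset m) s {x} → x ∈ f s → x ∈ ⋃ (tabulate f)
⋃-tabulate⁺ f zero    x∈ = x∈p∪q⁺ (inj₁ x∈)
⋃-tabulate⁺ f (suc s) x∈ = x∈p∪q⁺ (inj₂ (⋃-tabulate⁺ (λ i → f (suc i)) s x∈))

⋃-tabulate⁻ : ∀ {m t} (f : Fin t → Subset m) {x} → x ∈ ⋃ (tabulate f) → ∃ λ s → x ∈ f s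
⋃-tabulate⁻ {t = zero}  f x∈ = ⊥-elim (∉⊥ x∈)
⋃-tabulate⁻ {t = suc t} f x∈ with x∈p∪q⁻ (f zero) _ x∈
... | inj₁ x∈f₀ = zero , x∈f₀
... | inj₂ x∈⋃ = let (s , x∈fₛ) = ⋃-tabulate⁻ (λ i → f (suc i)) x∈⋃ in suc s , x∈fₛ

x∈p─q⇒x∉q : ∀ {m} {x : Fin m} (p q : Subset m) → x ∈ p ─ q → x ∉ q
x∈p─q⇒x∉q (_ ∷ p) (inside  ∷ q) (there x∈) (there x∈q) = x∈p─q⇒x∉q p q x∈ x∈q
x∈p─q⇒x∉q (_ ∷ p) (outside ∷ q) (there x∈) (there x∈q) = x∈p─q⇒x∉q p q x∈ x∈q

∃⊆-of-size : ∀ {n} m (p : Subset n) → m ≤ ∣ p ∣ → Σ (Subset n) λ q → q ⊆ p × ∣ q ∣ ≡ m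
∃⊆-of-size {n} zero p _ = ⊥ , (λ x∈ → ⊥-elim (∉⊥ x∈)) , ∣⊥∣≡0 n
∃⊆-of-size (suc m) (outside ∷ p) m<∣p∣ =
  let (q , q⊆p , ∣q∣≡) = ∃⊆-of-size (suc m) p m<∣p∣ in
  outside ∷ q , (λ { (there x∈) → there (q⊆p x∈) }) , ∣q∣≡
∃⊆-of-size (suc m) (inside ∷ p) (s≤s m≤∣p∣) =
  let (q , q⊆p , ∣q∣≡) = ∃⊆-of-size m p m≤∣p∣ in
  inside ∷ q , (λ { here → here ; (there x∈) → there (q⊆p x∈) }) , cong suc ∣q∣≡

record Selection (t : ℕ) (P : Fin t → Set) : Set where
  field
    size      : ℕ
    select    : Fin size → Fin t
    injective : ∀ {i j} → select i ≡ select j → i ≡ j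
    sound     : ∀ i → P (select i)
    complete  : ∀ s → P s → ∃ λ i → select i ≡ s

selection : ∀ t {P : Fin t → Set} → (∀ s → Dec (P s)) → Selection t P
selection zero P? = record
  { size = zero ; select = λ () ; injective = λ { {()} } ; sound = λ () ; complete = λ () }
selection (suc t) {P} P? with selection t (λ s → P? (suc s)) | P? zero
... | rest | yes P₀ = record
  { size = suc size ; select = select′ ; injective = injective′ ; sound = sound′ ; complete = complete′ }
  where
  open Selection rest
  select′ : Fin (suc size) → Fin (suc t)
  select′ zero    = zero
  select′ (suc i) = suc (select i)
  injective′ : ∀ {i j} → select′ i ≡ select′ j → i ≡ j
  injective′ {zero}  {zero}  _  = refl
  injective′ {suc i} {suc j} eq = cong suc (injective (suc-injective eq))
  sound′ : ∀ i → P (select′ i)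
  sound′ zero    = P₀
  sound′ (suc i) = sound i
  complete′ : ∀ s → P s → ∃ λ i → select′ i ≡ s
  complete′ zero    _   = zero , refl
  complete′ (suc s) Pₛ = let (i , eq) = complete s Pₛ in suc i , cong suc eq
... | rest | no ¬P₀ = record
  { size = size ; select = λ i → suc (select i)
  ; injective = λ eq → injective (suc-injective eq) ; sound = sound ; complete = complete′ }
  where
  open Selection rest
  complete′ : ∀ s → P s → ∃ λ i → suc (select i) ≡ s
  complete′ zero    P₀ = ⊥-elim (¬P₀ P₀)
  complete′ (suc s) Pₛ = let (i , eq) = complete s Pₛ in i , cong suc eq

walk-map : ∀ {m} {R R′ : Fin m → Fin m → Set} → (∀ {u v} → R u v → R′ u v) →
           ∀ {a b} → Walk R a b → Walk R′ a b
walk-map f here       = here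
walk-map f (step r w) = step (f r) (walk-map f w)

walk-preserves : ∀ {m} {R : Fin m → Fin m → Set} (P : Fin m → Set) →
                 (∀ {u w} → R u w → P u → P w) → ∀ {a b} → Walk R a b → P a → P b
walk-preserves P f here       Pa = Pa
walk-preserves P f (step r w) Pa = walk-preserves P f w (f r Pa)

module _ {H G : Graph} {K K′ : Sub G} {U U′ : Subset (n H)} (η : ModelFn H K U) where
  open ModelFn η

  restrict-ModelFn : (U′⊆U : U′ ⊆ U) →
                     (∀ {v} → v ∈ U′ → V (branch v) ⊆ V K′) →
                     (∀ {a b} → E K a b → a ∈ V K′ → b ∈ V K′ → E K′ a b) →
                     ModelFn H K′ U′
  restrict-ModelFn U′⊆U branch⊆K′ induced = record
    { branch      = branch
    ; branch-sub  = λ pv → branch⊆K′ pv , λ e →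
        let (a∈ , b∈ , _) = E-ok (branch _) e in
        induced (proj₂ (branch-sub (U′⊆U pv)) e) (branch⊆K′ pv a∈) (branch⊆K′ pv b∈)
    ; branch-conn = λ pv → branch-conn (U′⊆U pv)
    ; branch-disj = λ pu pv → branch-disj (U′⊆U pu) (U′⊆U pv)
    ; edge        = λ pu pv → edge (U′⊆U pu) (U′⊆U pv)
    ; edge-ok     = λ pu pv e →
        let (eK , a∈ , b∈) = edge-ok (U′⊆U pu) (U′⊆U pv) e in
        induced eK (branch⊆K′ pu a∈) (branch⊆K′ pv b∈) , a∈ , b∈
    ; edge-sym    = λ pu pv → edge-sym (U′⊆U pu) (U′⊆U pv)
    ; edge-inj    = λ pu pv e pu′ pv′ → edge-inj (U′⊆U pu) (U′⊆U pv) e (U′⊆U pu′) (U′⊆U pv′)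
    }

module RestrictedRoots {G : Graph} (A B : Sub G) where

  source : (Z : Roots G) → Fin (length (restrictRoots Z A B)) → Fin (length Z)
  source (X ∷ Z) j with X ⊆? V A
  source (X ∷ Z) zero    | yes _ = zero
  source (X ∷ Z) (suc j) | yes _ = suc (source Z j)
  source (X ∷ Z) j       | no  _ = suc (source Z j)

  preimage : (Z : Roots G) → Subset (length Z) → Subset (length (restrictRoots Z A B))
  preimage []      []      = []
  preimage (X ∷ Z) (b ∷ I) with X ⊆? V A
  ... | yes _ = b ∷ preimage Z I
  ... | no  _ = preimage Z I

  lookup-restrictRoots : ∀ Z j → lookup (restrictRoots Z A B) j ≡ lookup Z (source Z j) ∩ (V A ─ V B)
  lookup-restrictRoots (X ∷ Z) j with X ⊆? V A
  lookup-restrictRoots (X ∷ Z) zero    | yes _ = refl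
  lookup-restrictRoots (X ∷ Z) (suc j) | yes _ = lookup-restrictRoots Z j
  lookup-restrictRoots (X ∷ Z) j       | no  _ = lookup-restrictRoots Z j

  lookup-source-⊆ : ∀ Z j → lookup Z (source Z j) ⊆ V A
  lookup-source-⊆ (X ∷ Z) j with X ⊆? V A
  lookup-source-⊆ (X ∷ Z) zero    | yes X⊆A = X⊆A
  lookup-source-⊆ (X ∷ Z) (suc j) | yes _   = lookup-source-⊆ Z j
  lookup-source-⊆ (X ∷ Z) j       | no  _   = lookup-source-⊆ Z j

  ∈-preimage⁻ : ∀ Z I j → j ∈ preimage Z I → source Z j ∈ I
  ∈-preimage⁻ (X ∷ Z) (b ∷ I) j j∈ with X ⊆? V A
  ∈-preimage⁻ (X ∷ Z) (b ∷ I) zero    here       | yes _ = here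
  ∈-preimage⁻ (X ∷ Z) (b ∷ I) (suc j) (there j∈) | yes _ = there (∈-preimage⁻ Z I j j∈)
  ∈-preimage⁻ (X ∷ Z) (b ∷ I) j       j∈         | no  _ = there (∈-preimage⁻ Z I j j∈)

  ∈-preimage⁺ : ∀ Z I j → source Z j ∈ I → j ∈ preimage Z I
  ∈-preimage⁺ (X ∷ Z) (b ∷ I) j j∈ with X ⊆? V A
  ∈-preimage⁺ (X ∷ Z) (b ∷ I) zero    here       | yes _ = here
  ∈-preimage⁺ (X ∷ Z) (b ∷ I) (suc j) (there j∈) | yes _ = there (∈-preimage⁺ Z I j j∈)
  ∈-preimage⁺ (X ∷ Z) (b ∷ I) j       (there j∈) | no  _ = ∈-preimage⁺ Z I j j∈

  ∣I∣≤∣preimage∣+‖Z∖A‖ : ∀ Z I → ∣ I ∣ ≤ ∣ preimage Z I ∣ + ‖ Z ∖ A ‖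
  ∣I∣≤∣preimage∣+‖Z∖A‖ []      []      = z≤n
  ∣I∣≤∣preimage∣+‖Z∖A‖ (X ∷ Z) (b ∷ I) with X ⊆? V A
  ∣I∣≤∣preimage∣+‖Z∖A‖ (X ∷ Z) (inside  ∷ I) | yes _ = s≤s (∣I∣≤∣preimage∣+‖Z∖A‖ Z I)
  ∣I∣≤∣preimage∣+‖Z∖A‖ (X ∷ Z) (outside ∷ I) | yes _ = ∣I∣≤∣preimage∣+‖Z∖A‖ Z I
  ∣I∣≤∣preimage∣+‖Z∖A‖ (X ∷ Z) (inside  ∷ I) | no  _ =
    ≤-trans (s≤s (∣I∣≤∣preimage∣+‖Z∖A‖ Z I)) (≤-reflexive (≡-sym (+-suc _ _)))
  ∣I∣≤∣preimage∣+‖Z∖A‖ (X ∷ Z) (outside ∷ I) | no  _ =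
    ≤-trans (∣I∣≤∣preimage∣+‖Z∖A‖ Z I) (+-monoʳ-≤ _ (n≤1+n _))

module SeparationSides {G : Graph} (A B : Sub G) (sep : IsSeparation G A B) (T : Subset (n G)) where

  S : Subset (n G)
  S = T ∪ (V A ∩ V B)

  outer : Sub G
  outer = whole G -ᵥ S

  inner : Sub G
  inner = (A minusV B) -ᵥ T

  ∉S⇒∉T : ∀ {x} → x ∉ S → x ∉ T
  ∉S⇒∉T x∉S x∈T = x∉S (x∈p∪q⁺ (inj₁ x∈T))

  ∉S∧∈A⇒∉B : ∀ {x} → x ∉ S → x ∈ V A → x ∉ V B
  ∉S∧∈A⇒∉B x∉S x∈A x∈B = x∉S (x∈p∪q⁺ (inj₂ (x∈p∩q⁺ (x∈A , x∈B))))

  ∉B⇒∈A : ∀ {x} → x ∉ V B → x ∈ V A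
  ∉B⇒∈A {x} x∉B with proj₁ sep x
  ... | inj₁ x∈A = x∈A
  ... | inj₂ x∈B = ⊥-elim (x∉B x∈B)

  ∉B⇒edge-in-A : ∀ {u w} → Adj G u w → u ∉ V B → E A u w
  ∉B⇒edge-in-A uw u∉B with proj₁ (proj₂ sep) uw
  ... | inj₁ eA = eA
  ... | inj₂ eB = ⊥-elim (u∉B (proj₁ (E-ok B eB)))

  outer-walk-avoids-B : ∀ {u w} → Walk (E outer) u w → u ∉ V B → w ∉ V B
  outer-walk-avoids-B = walk-preserves (_∉ V B) λ (uw , _ , w∉S) u∉B →
    ∉S∧∈A⇒∉B w∉S (proj₁ (proj₂ (E-ok A (∉B⇒edge-in-A uw u∉B))))

  outer∖B⊆inner : ∀ {x} → x ∈ V outer → x ∉ V B → x ∈ V inner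
  outer∖B⊆inner x∈ x∉B =
    x∈p∧x∉q⇒x∈p─q (x∈p∧x∉q⇒x∈p─q (∉B⇒∈A x∉B) x∉B) (∉S⇒∉T (x∈p─q⇒x∉q ⊤ S x∈))

  inner-induced : ∀ {a b} → E outer a b → a ∈ V inner → b ∈ V inner → E inner a b
  inner-induced (ab , _) a∈ b∈ =
    (∉B⇒edge-in-A ab (∉B a∈) , ∉B a∈ , ∉B b∈) , x∈p─q⇒x∉q _ T a∈ , x∈p─q⇒x∉q _ T b∈
    where
    ∉B : ∀ {x} → x ∈ V inner → x ∉ V B
    ∉B x∈ = x∈p─q⇒x∉q (V A) (V B) (p─q⊆p _ T x∈)

module PureModelOnASide {H G : Graph} (Z : Roots G) (A B : Sub G) (sep : IsSeparation G A B)
                        (T : Subset (n G)) {ℓ : ℕ} (M : PureModel H (SeparationSides.outer A B sep T) Z ℓ) where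
  open SeparationSides A B sep T
  open RestrictedRoots A B
  open PureModel M
  open ModelFn η

  U : Subset (n H)
  U = ⋃ (tabulate comp)

  AvoidsB : Fin (n H) → Set
  AvoidsB v = ∀ {y} → y ∈ V (branch v) → y ∉ V B

  branch-avoids-B : ∀ {v x} → v ∈ U → x ∈ V (branch v) → x ∉ V B → AvoidsB v
  branch-avoids-B pv x∈ x∉B y∈ =
    outer-walk-avoids-B (walk-map (proj₂ (branch-sub pv)) (proj₂ (branch-conn pv) x∈ y∈)) x∉B

  component-avoids-B : ∀ s {v w} → v ∈ comp s → w ∈ comp s → AvoidsB v → AvoidsB w
  component-avoids-B s v∈ w∈ v-avoids =
    proj₂ (walk-preserves (λ u → u ∈ comp s × AvoidsB u) step-avoids
            (proj₂ (proj₂ (comp-ok s)) v∈ w∈) (v∈ , v-avoids))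
    where
    step-avoids : ∀ {u w} → Adj H u w → u ∈ comp s × AvoidsB u → w ∈ comp s × AvoidsB w
    step-avoids uw (u∈ , u-avoids) =
      let w∈ = proj₁ (proj₂ (comp-ok s)) u∈ uw
          (eK , a∈ , b∈) = edge-ok (⋃-tabulate⁺ comp s u∈) (⋃-tabulate⁺ comp s w∈) uw
      in w∈ , branch-avoids-B (⋃-tabulate⁺ comp s w∈) b∈ (outer-walk-avoids-B (step eK here) (u-avoids a∈))

  root-in-branch-avoids-B : ∀ s {j} → source Z j ∈ α s →
    ∃ λ x → x ∈ lookup Z (source Z j) × (∃ λ v → v ∈ comp s × x ∈ V (branch v) × x ∉ V B)
  root-in-branch-avoids-B s {j} j∈ =
    let (x , x∈X , v , v∈ , x∈br) = meets s j∈
        x∉S = x∈p─q⇒x∉q ⊤ S (proj₁ (branch-sub (⋃-tabulate⁺ comp s v∈)) x∈br)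
    in x , x∈X , v , v∈ , x∈br , ∉S∧∈A⇒∉B x∉S (lookup-source-⊆ Z j x∈X)

  module _ {ℓ′ : ℕ} (‖Z∖A‖≡ℓ′ : ‖ Z ∖ A ‖ ≡ ℓ′) where

    enough-restricted-roots : ℓ ∸ ℓ′ ≤ ∣ preimage Z (⋃ (tabulate α)) ∣
    enough-restricted-roots =
      ≤-trans (∸-monoˡ-≤ ℓ′ (subst₂ (λ a b → a ≤ ∣ preimage Z (⋃ (tabulate α)) ∣ + b) α-size ‖Z∖A‖≡ℓ′
                              (∣I∣≤∣preimage∣+‖Z∖A‖ Z (⋃ (tabulate α)))))
              (≤-reflexive (m+n∸n≡m _ ℓ′))

    chosen-of-size : Σ (Subset (length (restrictRoots Z A B))) λ I →
                       I ⊆ preimage Z (⋃ (tabulate α)) × ∣ I ∣ ≡ ℓ ∸ ℓ′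
    chosen-of-size = ∃⊆-of-size (ℓ ∸ ℓ′) (preimage Z (⋃ (tabulate α))) enough-restricted-roots

    chosen : Subset (length (restrictRoots Z A B))
    chosen = proj₁ chosen-of-size

    α′ : Fin t → Subset (length (restrictRoots Z A B))
    α′ s = preimage Z (α s) ∩ chosen

    ∈α′⇒source∈α : ∀ {s j} → j ∈ α′ s → source Z j ∈ α s
    ∈α′⇒source∈α {s} {j} j∈ = ∈-preimage⁻ Z (α s) j (proj₁ (x∈p∩q⁻ _ _ j∈))

    open Selection (selection t (λ s → nonempty? (α′ s)))

    U′ : Subset (n H)
    U′ = ⋃ (tabulate (λ i → comp (select i)))

    U′⊆U : U′ ⊆ U
    U′⊆U v∈ = let (i , v∈ᵢ) = ⋃-tabulate⁻ _ v∈ in ⋃-tabulate⁺ comp (select i) v∈ᵢ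

    selected-avoids-B : ∀ {v} → v ∈ U′ → AvoidsB v
    selected-avoids-B v∈ =
      let (i , v∈ᵢ) = ⋃-tabulate⁻ _ v∈
          (j , j∈) = sound i
          (_ , _ , v₀ , v₀∈ , x∈br , x∉B) = root-in-branch-avoids-B (select i) (∈α′⇒source∈α j∈)
      in component-avoids-B (select i) v₀∈ v∈ᵢ (branch-avoids-B (⋃-tabulate⁺ comp _ v₀∈) x∈br x∉B)

    η′ : ModelFn H inner U′
    η′ = restrict-ModelFn η U′⊆U
           (λ pv y∈ → outer∖B⊆inner (proj₁ (branch-sub (U′⊆U pv)) y∈) (selected-avoids-B pv y∈))
           inner-induced

    α′-disjoint : ∀ {s s′} → ¬ s ≡ s′ → Empty (α′ s ∩ α′ s′)
    α′-disjoint s≢s′ (j , j∈) = let (j∈ₛ , j∈ₛ′) = x∈p∩q⁻ _ _ j∈ in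
      α-disj s≢s′ (source Z j , x∈p∩q⁺ (∈α′⇒source∈α j∈ₛ , ∈α′⇒source∈α j∈ₛ′))

    ⋃α′≡chosen : ⋃ (tabulate (λ i → α′ (select i))) ≡ chosen
    ⋃α′≡chosen = ⊆-antisym
      (λ j∈ → let (i , j∈ᵢ) = ⋃-tabulate⁻ (λ i → α′ (select i)) j∈ in p∩q⊆q _ _ j∈ᵢ)
      (λ {j} j∈ →
        let (s , j∈ₛ) = ⋃-tabulate⁻ α (∈-preimage⁻ Z _ j (proj₁ (proj₂ chosen-of-size) j∈))
            j∈α′ₛ = x∈p∩q⁺ (∈-preimage⁺ Z (α s) j j∈ₛ , j∈)
            (i , select≡s) = complete s (j , j∈α′ₛ)
        in ⋃-tabulate⁺ _ i (subst (λ s → j ∈ α′ s) (≡-sym select≡s) j∈α′ₛ))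

    pureModel-inner : PureModel H inner (restrictRoots Z A B) (ℓ ∸ ℓ′)
    pureModel-inner = record
      { t             = size
      ; comp          = λ i → comp (select i)
      ; comp-ok       = λ i → comp-ok (select i)
      ; comp-distinct = λ i≢j eq → comp-distinct (λ eq′ → i≢j (injective eq′)) eq
      ; η             = η′
      ; α             = λ i → α′ (select i)
      ; α-nonempty    = sound
      ; α-disj        = λ i≢j → α′-disjoint (λ eq → i≢j (injective eq))
      ; α-size        = ≡-trans (cong ∣_∣ ⋃α′≡chosen) (proj₂ (proj₂ chosen-of-size))
      ; meets         = λ i {j} j∈ →
          let (x , x∈X , v , v∈ , x∈br , x∉B) = root-in-branch-avoids-B (select i) (∈α′⇒source∈α j∈)
          in x , subst (x ∈_) (≡-sym (lookup-restrictRoots Z j))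
                   (x∈p∩q⁺ (x∈X , x∈p∧x∉q⇒x∈p─q (lookup-source-⊆ Z j x∈X) x∉B))
             , v , v∈ , x∈br
      }

lemma4p7 : (ℓ ℓ' : ℕ) → 1 ≤ ℓ → (H G : Graph) (Z : Roots G) (A B : Sub G)
    → IsSeparation G A B → ‖ Z ∖ A ‖ ≡ ℓ' → 1 ≤ ℓ' → ℓ' < ℓ
    → (T : Subset (n G))
    → IsPureDeletionSet H (A minusV B) (restrictRoots Z A B) (ℓ ∸ ℓ') T
    → IsPureDeletionSet H (whole G) Z ℓ (T ∪ (V A ∩ V B))
lemma4p7 ℓ ℓ' _ H G Z A B sep ‖Z∖A‖≡ℓ' _ _ T (_ , no-inner-model) =
  (λ _ → ∈⊤) , λ M → no-inner-model (PureModelOnASide.pureModel-inner Z A B sep T M ‖Z∖A‖≡ℓ')
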